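{- A graph $G$ has exactly one L-Grundy dominating set (i.e., $G$ is a unique L-Grundy domination graph) if and only if $\gamma_{gr}^{L}(G)=n(G)$.
   Context: For a vertex $v$, $N(v)$ is its open and $N[v]=N(v)\cup\{v\}$ its closed neighborhood. An L-sequence of $G$ is a sequence $(v_1,\ldots,v_k)$ of distinct vertices such that for each $i\in[k]$, $N[v_i]\setminus\bigcup_{j=1}^{i-1}N(v_j)\neq\emptyset$. $\gamma_{gr}^{L}(G)$ is the maximum length of an L-sequence, and an L-Grundy dominating set is the set of vertices of an L-sequence of maximum length. $n(G)$ is the number of vertices of $G$. -}

module Defs where

open import Data.Nat using (ℕ; _≤_; _<_)
open import Data.Bool using (Bool; T)
open import Data.Fin using (Fin; toℕ)
open import Data.Fin.Subset using (Subset; _∈_)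
open import Data.List using (List; length; lookup)
open import Data.List.Relation.Unary.Unique.Propositional using (Unique)
import Data.List.Membership.Propositional as L
open import Data.Product using (Σ; ∃; _×_)
open import Data.Sum using (_⊎_)
open import Relation.Nullary using (¬_)
open import Relation.Binary.PropositionalEquality using (_≡_)
open import Function.Bundles using (_⇔_)

record Graph (n : ℕ) : Set where
  field
    adj   : Fin n → Fin n → Bool
    sym   : ∀ u v → adj u v ≡ adj v u
    irrefl : ∀ v → adj v v ≡ Data.Bool.false

open Graph public

InOpenNbhd : ∀ {n} → Graph n → Fin n → Fin n → Set
InOpenNbhd G v w = T (adj G v w)

InClosedNbhd : ∀ {n} → Graph n → Fin n → Fin n → Set
InClosedNbhd G v w = (w ≡ v) ⊎ InOpenNbhd G v w

IsLSequence : ∀ {n} → Graph n → List (Fin n) → Set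
IsLSequence G s =
  Unique s ×
  ((i : Fin (length s)) →
     ∃ λ w → InClosedNbhd G (lookup s i) w ×
       ((j : Fin (length s)) → toℕ j < toℕ i → ¬ InOpenNbhd G (lookup s j) w))

IsMaxLSequence : ∀ {n} → Graph n → List (Fin n) → Set
IsMaxLSequence G s =
  IsLSequence G s × (∀ t → IsLSequence G t → length t ≤ length s)

LGrundyNumberIs : ∀ {n} → Graph n → ℕ → Set
LGrundyNumberIs G k = ∃ λ s → IsMaxLSequence G s × length s ≡ k

IsLGrundyDomSet : ∀ {n} → Graph n → Subset n → Set
IsLGrundyDomSet G S = ∃ λ s → IsMaxLSequence G s × (∀ v → (v ∈ S) ⇔ (v L.∈ s))

UniqueLGrundyDomGraph : ∀ {n} → Graph n → Set
UniqueLGrundyDomGraph G =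
  ∃ λ S → IsLGrundyDomSet G S × (∀ T → IsLGrundyDomSet G T → T ≡ S)

{-# OPTIONS --safe #-}
-- Call w a footprint of x after v_1, …, v_p if w ∈ N[x] \ ⋃_{j ≤ p} N(v_j).
-- Every vertex x lies in some maximum L-sequence (v_1, …, v_k): take the last m such that
-- x has a footprint after v_1, …, v_{m-1} and replace v_m by x. A later term v_i keeps its
-- footprint w, for w ∈ N(x) would make w a footprint of x after v_1, …, v_m. Hence a
-- unique L-Grundy dominating set is all of V(G). Conversely, if γ_gr^L(G) = n then every
-- maximum L-sequence contains every vertex, so V(G) is the only L-Grundy dominating set.
module Submission where

open import Defs hiding (sym)
open import Data.Bool using (T?)
open import Data.Empty using (⊥-elim)
open import Data.Fin using (Fin; zero; suc; toℕ; fromℕ<; cast; _≟_)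
open import Data.Fin.Properties
  using (any?; all?; toℕ-fromℕ<; toℕ-cast; toℕ<n; cast-involutive; injective⇒≤)
open import Data.Fin.Subset using (Subset; _∈_; ⊤; ⊥; ⁅_⁆; _∪_)
open import Data.Fin.Subset.Properties
  using (∈⊤; ⊆⊤; ⊆-antisym; ∉⊥; x∈⁅x⁆; x∈⁅y⁆⇒x≡y; x∈p∪q⁺; x∈p∪q⁻)
open import Data.List using (List; []; _∷_; [_]; length; lookup; tabulate; foldr)
open import Data.List.Properties using (length-tabulate; lookup-tabulate)
open import Data.List.Membership.Propositional using () renaming (_∈_ to _∈ˡ_; _∉_ to _∉ˡ_)
open import Data.List.Membership.Propositional.Properties using (∈-lookup; ∈-tabulate⁺)
open import Data.List.Membership.Setoid.Properties using (index-injective)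
import Data.List.Relation.Unary.All as All
open import Data.List.Relation.Unary.All.Properties using (¬Any⇒All¬)
open import Data.List.Relation.Unary.Any using (here; there)
open import Data.List.Relation.Unary.AllPairs using ([]; _∷_)
open import Data.List.Relation.Unary.Unique.Propositional using (Unique)
open import Data.List.Relation.Unary.Unique.Propositional.Properties using (tabulate⁺)
open import Data.Nat using (ℕ; zero; suc; _≤_; _<_; z≤n; s≤s; s<s⁻¹; _≤?_; _<?_)
open import Data.Nat.Properties
  using (≤-refl; ≤-antisym; ≤-<-trans; <-≤-trans; <-irrefl; ≰⇒>; m≤n⇒m≤1+n; m<1+n⇒m<n∨m≡n; 1+n≰n)
open import Data.Product using (∃; _×_; _,_; proj₁)
open import Data.Sum using (inj₁; inj₂; [_,_]′)
open import Data.Vec.Functional using (Vector; updateAt)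
open import Data.Vec.Functional.Properties using (updateAt-updates; updateAt-minimal)
open import Function using (const; _∘_)
open import Function.Bundles using (_⇔_; mk⇔; Equivalence)
open import Function.Definitions using (Injective)
open import Relation.Binary.PropositionalEquality
  using (_≡_; _≢_; refl; sym; trans; cong; subst; subst₂; setoid)
open import Relation.Nullary using (¬_; Dec; yes; no; contradiction)
open import Relation.Nullary.Decidable using (_⊎-dec_; _×-dec_; _→-dec_; ¬?)
import Relation.Unary as U

lastSatisfying : ∀ {p} {P : ℕ → Set p} → U.Decidable P → P 0 → ∀ k →
                 ∃ λ m → m ≤ k × P m × (m < k → ¬ P (suc m))
lastSatisfying P? P0 zero = 0 , z≤n , P0 , λ ()
lastSatisfying P? P0 (suc k) with P? (suc k)
... | yes P1+k = suc k , ≤-refl , P1+k , λ k<k → contradiction k<k (<-irrefl refl)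
... | no ¬P1+k with lastSatisfying P? P0 k
...   | m , m≤k , Pm , last = m , m≤n⇒m≤1+n m≤k , Pm ,
        [ last , (λ { refl → ¬P1+k }) ]′ ∘ m<1+n⇒m<n∨m≡n

lookup-injective : ∀ {a} {A : Set a} {xs : List A} → Unique xs → Injective _≡_ _≡_ (lookup xs)
lookup-injective (_ ∷ _)    {zero}  {zero}  _ = refl
lookup-injective (x≢xs ∷ _) {zero}  {suc j} e = contradiction e (All.lookup x≢xs (∈-lookup j))
lookup-injective (x≢xs ∷ _) {suc i} {zero}  e = contradiction (sym e) (All.lookup x≢xs (∈-lookup i))
lookup-injective (_ ∷ u)    {suc i} {suc j} e = cong suc (lookup-injective u e)

updateAt-const-injective : ∀ {a} {A : Set a} {k} {f : Vector A k} {x : A} →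
  Injective _≡_ _≡_ f → (∀ i → f i ≢ x) → (m : Fin k) → Injective _≡_ _≡_ (updateAt f m (const x))
updateAt-const-injective {f = f} {x} f-inj fi≢x m = g-inj
  where
  g = updateAt f m (const x)
  g-at-m : g m ≡ x
  g-at-m = updateAt-updates m f
  g-off-m : ∀ {j} → j ≢ m → g j ≡ f j
  g-off-m j≢m = updateAt-minimal _ m f j≢m

  g-inj : Injective _≡_ _≡_ g
  g-inj {i} {j} e with i ≟ m | j ≟ m
  ... | yes refl | yes refl = refl
  ... | yes refl | no j≢m   = contradiction (trans (sym (g-off-m j≢m)) (trans (sym e) g-at-m)) (fi≢x j)
  ... | no i≢m   | yes refl = contradiction (trans (sym (g-off-m i≢m)) (trans e g-at-m)) (fi≢x i)
  ... | no i≢m   | no j≢m   = f-inj (trans (sym (g-off-m i≢m)) (trans e (g-off-m j≢m)))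

lookup-tabulate-cast : ∀ {a} {A : Set a} {k} (f : Vector A k) (i : Fin (length (tabulate f))) →
                   lookup (tabulate f) i ≡ f (cast (length-tabulate f) i)
lookup-tabulate-cast f i =
  trans (cong (lookup (tabulate f)) (sym (cast-involutive (sym e) e i)))
        (lookup-tabulate f (cast e i))
  where e = length-tabulate f

module _ {n : ℕ} where
  open import Data.List.Membership.DecPropositional (_≟_ {n}) using (_∈?_)

  Unique⇒length≤ : {xs : List (Fin n)} → Unique xs → length xs ≤ n
  Unique⇒length≤ u = injective⇒≤ (lookup-injective u)

  complete⇒length≥ : {xs : List (Fin n)} → (∀ x → x ∈ˡ xs) → n ≤ length xs
  complete⇒length≥ ∈xs = injective⇒≤ (index-injective (setoid _) (∈xs _) (∈xs _))

  Unique∧length≡⇒complete : {xs : List (Fin n)} → Unique xs → length xs ≡ n → ∀ x → x ∈ˡ xs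
  Unique∧length≡⇒complete {xs} u len x with x ∈? xs
  ... | yes x∈xs = x∈xs
  ... | no x∉xs = contradiction (subst (λ k → suc k ≤ n) len (Unique⇒length≤ x∷xs-unique)) 1+n≰n
    where x∷xs-unique = ¬Any⇒All¬ xs x∉xs ∷ u

  toSubset : List (Fin n) → Subset n
  toSubset = foldr (λ y S → ⁅ y ⁆ ∪ S) ⊥

  ∈-toSubset : ∀ xs {x} → x ∈ toSubset xs ⇔ x ∈ˡ xs
  ∈-toSubset [] = mk⇔ (⊥-elim ∘ ∉⊥) λ ()
  ∈-toSubset (y ∷ xs) {x} = mk⇔
    ([ here ∘ x∈⁅y⁆⇒x≡y y , there ∘ Equivalence.to (∈-toSubset xs) ]′ ∘ x∈p∪q⁻ ⁅ y ⁆ (toSubset xs))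
    λ { (here refl)  → x∈p∪q⁺ (inj₁ (x∈⁅x⁆ x))
      ; (there x∈xs) → x∈p∪q⁺ (inj₂ (Equivalence.from (∈-toSubset xs) x∈xs)) }

module _ {n : ℕ} (G : Graph n) where
  open import Data.List.Membership.DecPropositional (_≟_ {n}) using (_∈?_)

  OutsideOpenNbhds : ∀ {k} → Vector (Fin n) k → ℕ → Fin n → Set
  OutsideOpenNbhds f p w = ∀ j → toℕ j < p → ¬ InOpenNbhd G (f j) w

  HasFootprint : ∀ {k} → Vector (Fin n) k → ℕ → Fin n → Set
  HasFootprint f p v = ∃ λ w → InClosedNbhd G v w × OutsideOpenNbhds f p w

  -- IsLSequence G s unfolds to Unique s × LCondition (lookup s).
  LCondition : ∀ {k} → Vector (Fin n) k → Set
  LCondition f = ∀ i → HasFootprint f (toℕ i) (f i)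

  HasFootprint? : ∀ {k} (f : Vector (Fin n) k) p v → Dec (HasFootprint f p v)
  HasFootprint? f p v = any? λ w → (w ≟ v ⊎-dec T? (adj G v w)) ×-dec
                                   all? (λ j → toℕ j <? p →-dec ¬? (T? (adj G (f j) w)))

  HasFootprint-⊆ : ∀ {k k′} {f : Vector (Fin n) k} {g : Vector (Fin n) k′} {p v} →
    (∀ j → toℕ j < p → ∃ λ j′ → toℕ j′ < p × g j ≡ f j′) → HasFootprint f p v → HasFootprint g p v
  HasFootprint-⊆ g⊆f (w , v~w , out) = w , v~w , λ j j<p j~w →
    let j′ , j′<p , gj≡fj′ = g⊆f j j<p
    in out j′ j′<p (subst (λ u → InOpenNbhd G u w) gj≡fj′ j~w)

  updateAt-LCondition : ∀ {k} {f : Vector (Fin n) k} {x} (m : Fin k) → LCondition f →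
    HasFootprint f (toℕ m) x → (suc (toℕ m) < k → ¬ HasFootprint f (suc (toℕ m)) x) →
    LCondition (updateAt f m (const x))
  updateAt-LCondition {k} {f} {x} m lc x-fp x-last = footprint
    where
    g = updateAt f m (const x)
    g-at-m : g m ≡ x
    g-at-m = updateAt-updates m f
    g-off-m : ∀ {j} → j ≢ m → g j ≡ f j
    g-off-m j≢m = updateAt-minimal _ m f j≢m

    unchanged-below : ∀ {p} → p ≤ toℕ m → ∀ j → toℕ j < p → ∃ λ j′ → toℕ j′ < p × g j ≡ f j′
    unchanged-below p≤m j j<p = j , j<p , g-off-m (λ { refl → <-irrefl refl (<-≤-trans j<p p≤m) })

    footprint-after-m : ∀ {i v} → toℕ m < toℕ i →
                        HasFootprint f (toℕ i) v → HasFootprint g (toℕ i) v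
    footprint-after-m {i} m<i (w , v~w , out) = w , v~w , out′
      where
      out′ : OutsideOpenNbhds g (toℕ i) w
      out′ j j<i with j ≟ m
      ... | yes refl = λ x~w → x-last (≤-<-trans m<i (toℕ<n i))
              (w , inj₂ (subst (λ u → InOpenNbhd G u w) g-at-m x~w) ,
               λ j′ j′≤m → out j′ (<-≤-trans j′≤m m<i))
      ... | no j≢m = subst (λ u → ¬ InOpenNbhd G u w) (sym (g-off-m j≢m)) (out j j<i)

    old-footprint : ∀ i → HasFootprint g (toℕ i) (f i)
    old-footprint i with toℕ i ≤? toℕ m
    ... | yes i≤m = HasFootprint-⊆ (unchanged-below i≤m) (lc i)
    ... | no i≰m  = footprint-after-m (≰⇒> i≰m) (lc i)

    footprint : LCondition g
    footprint i with i ≟ m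
    ... | yes refl =
      subst (HasFootprint g (toℕ m)) (sym g-at-m) (HasFootprint-⊆ (unchanged-below ≤-refl) x-fp)
    ... | no i≢m   = subst (HasFootprint g (toℕ i)) (sym (g-off-m i≢m)) (old-footprint i)

  exchange : ∀ {k} (f : Vector (Fin n) (suc k)) → LCondition f → ∀ x →
             ∃ λ m → LCondition (updateAt f m (const x))
  exchange {k} f lc x with lastSatisfying (λ p → HasFootprint? f p x) (x , inj₁ refl , λ _ ()) k
  ... | p , p≤k , x-fp , x-last = m , updateAt-LCondition m lc
        (subst (λ q → HasFootprint f q x) (sym m≡p) x-fp)
        (subst (λ q → suc q < suc k → ¬ HasFootprint f (suc q) x) (sym m≡p) (x-last ∘ s<s⁻¹))
    where
    m = fromℕ< (s≤s p≤k)
    m≡p : toℕ m ≡ p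
    m≡p = toℕ-fromℕ< (s≤s p≤k)

  tabulate-IsLSequence : ∀ {k} {f : Vector (Fin n) k} → Injective _≡_ _≡_ f → LCondition f →
                         IsLSequence G (tabulate f)
  tabulate-IsLSequence {f = f} f-inj lc = tabulate⁺ f-inj , λ i →
    HasFootprint-⊆
      (λ j j<i → c j , subst (_< toℕ i) (sym (toℕ-cast e j)) j<i , lookup-tabulate-cast f j)
      (subst₂ (HasFootprint f) (toℕ-cast e i) (sym (lookup-tabulate-cast f i)) (lc (c i)))
    where
    e = length-tabulate f
    c = cast e

  singleton-IsLSequence : ∀ x → IsLSequence G [ x ]
  singleton-IsLSequence x = All.[] ∷ [] , λ { zero → x , inj₁ refl , λ _ () }

  exchange-into-max : ∀ {s x} → IsMaxLSequence G s → x ∉ˡ s → ∃ λ t → IsMaxLSequence G t × x ∈ˡ t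
  exchange-into-max {[]} {x} (_ , longest) _ =
    contradiction (longest [ x ] (singleton-IsLSequence x)) λ ()
  exchange-into-max {s@(_ ∷ _)} {x} ((u , lc) , longest) x∉s with exchange (lookup s) lc x
  ... | m , lc′ = tabulate g , (tabulate-IsLSequence g-inj lc′ , longest′) , x∈t
    where
    g = updateAt (lookup s) m (const x)
    g-inj : Injective _≡_ _≡_ g
    g-inj = updateAt-const-injective (lookup-injective u)
              (λ i e → x∉s (subst (_∈ˡ s) e (∈-lookup i))) m
    longest′ : ∀ t → IsLSequence G t → length t ≤ length (tabulate g)
    longest′ t t-seq = subst (length t ≤_) (sym (length-tabulate g)) (longest t t-seq)
    x∈t : x ∈ˡ tabulate g
    x∈t = subst (_∈ˡ tabulate g) (updateAt-updates m (lookup s)) (∈-tabulate⁺ {f = g} m)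

  maxLSequence-through : ∀ {s} → IsMaxLSequence G s → ∀ x → ∃ λ t → IsMaxLSequence G t × x ∈ˡ t
  maxLSequence-through {s} max-s x with x ∈? s
  ... | yes x∈s = s , max-s , x∈s
  ... | no x∉s = exchange-into-max max-s x∉s

  maxLSequence-complete : ∀ {s t} → IsMaxLSequence G s → length s ≡ n → IsMaxLSequence G t →
                          ∀ x → x ∈ˡ t
  maxLSequence-complete (s-seq , s-longest) len (t-seq , t-longest) =
    Unique∧length≡⇒complete (proj₁ t-seq)
      (trans (≤-antisym (s-longest _ t-seq) (t-longest _ s-seq)) len)

corollary6p3 : (n : ℕ) (G : Graph n) →
    UniqueLGrundyDomGraph G ⇔ LGrundyNumberIs G n
corollary6p3 n G = mk⇔ unique⇒γ≡n γ≡n⇒unique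
  where
  unique⇒γ≡n : UniqueLGrundyDomGraph G → LGrundyNumberIs G n
  unique⇒γ≡n (S , (s , max-s , S≈s) , unique) =
    s , max-s , ≤-antisym (Unique⇒length≤ (proj₁ (proj₁ max-s))) (complete⇒length≥ s-complete)
    where
    s-complete : ∀ x → x ∈ˡ s
    s-complete x =
      let t , max-t , x∈t = maxLSequence-through G max-s x
          t≡S = unique (toSubset t) (t , max-t , λ _ → ∈-toSubset t)
      in Equivalence.to (S≈s x) (subst (x ∈_) t≡S (Equivalence.from (∈-toSubset t) x∈t))

  γ≡n⇒unique : LGrundyNumberIs G n → UniqueLGrundyDomGraph G
  γ≡n⇒unique (s , max-s , len) =
    ⊤ , (s , max-s , λ v → mk⇔ (λ _ → complete max-s v) (λ _ → ∈⊤)) ,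
    λ { T (t , max-t , T≈t) →
          ⊆-antisym ⊆⊤ (λ _ → Equivalence.from (T≈t _) (complete max-t _)) }
    where
    complete : ∀ {t} → IsMaxLSequence G t → ∀ x → x ∈ˡ t
    complete = maxLSequence-complete G max-s len
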